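{- Let $\mathbf L=(L,\vee,\wedge,0,1)$ be a complemented lattice and $D$ a deductive system of $\mathbf L$. Then: (i) $D$ is an order filter of $\mathbf L$ (i.e. $a\in D$ and $a\le b$ imply $b\in D$); (ii) if $x\to y\subseteq D$ for all $x,y\in D$, then $D$ is a filter of $\mathbf L$.
   Context: A bounded lattice is complemented if every element $a$ has some $b$ with $a\vee b=1$, $a\wedge b=0$ (complements need not be unique); lattices are non-trivial. For $a\in L$, $a^+:=\{x\in L\mid a\vee x=1,\ a\wedge x=0\}$, and $a\to b:=\{x\vee(a\wedge b)\mid x\in a^+\}$; singletons are identified with elements. A deductive system of $\mathbf L$ is a subset $D\subseteq L$ with $1\in D$ such that whenever $a\in D$, $b\in L$ and $a\to b\subseteq D$, then $b\in D$. A filter is a non-empty up-set closed under $\wedge$. -}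

module Defs where

open import Level using (Level; _⊔_; suc)
open import Data.Product using (_×_; ∃)
open import Relation.Nullary using (¬_)
open import Algebra.Lattice.Bundles using (Lattice)

-- A bounded, complemented, non-trivial lattice (complements need not be unique).
record ComplementedLattice (c ℓ : Level) : Set (suc (c ⊔ ℓ)) where
  field
    lattice : Lattice c ℓ
  open Lattice lattice public
  field
    𝟘 : Carrier
    𝟙 : Carrier
    ∨-identityʳ : ∀ x → (x ∨ 𝟘) ≈ x
    ∧-identityʳ : ∀ x → (x ∧ 𝟙) ≈ x
    complemented : ∀ a → ∃ λ b → ((a ∨ b) ≈ 𝟙) × ((a ∧ b) ≈ 𝟘)
    nontrivial : ¬ (𝟘 ≈ 𝟙)

module _ {c ℓ : Level} (L : ComplementedLattice c ℓ) where
  open ComplementedLattice L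

  _≤_ : Carrier → Carrier → Set ℓ
  a ≤ b = (a ∧ b) ≈ a

  _⁺ : Carrier → Carrier → Set ℓ
  (a ⁺) x = ((a ∨ x) ≈ 𝟙) × ((a ∧ x) ≈ 𝟘)

  -- a → b = { x ∨ (a ∧ b) | x ∈ a⁺ };  (a → b) ⊆ D
  Imp⊆ : ∀ {d} → Carrier → Carrier → (Carrier → Set d) → Set (c ⊔ ℓ ⊔ d)
  Imp⊆ a b D = ∀ x → (a ⁺) x → D (x ∨ (a ∧ b))

  Respects≈ : ∀ {d} → (Carrier → Set d) → Set (c ⊔ ℓ ⊔ d)
  Respects≈ D = ∀ {x y} → x ≈ y → D x → D y

  IsDeductiveSystem : ∀ {d} → (Carrier → Set d) → Set (c ⊔ ℓ ⊔ d)
  IsDeductiveSystem D =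
    D 𝟙 × (∀ a b → D a → Imp⊆ a b D → D b)

  IsOrderFilter : ∀ {d} → (Carrier → Set d) → Set (c ⊔ ℓ ⊔ d)
  IsOrderFilter D = ∀ a b → D a → a ≤ b → D b

  IsFilter : ∀ {d} → (Carrier → Set d) → Set (c ⊔ ℓ ⊔ d)
  IsFilter D = (∃ λ a → D a) × IsOrderFilter D × (∀ a b → D a → D b → D (a ∧ b))

module Submission where

open import Defs
open import Level using (Level)
open import Data.Product using (_×_; _,_)
import Algebra.Lattice.Properties.Lattice as LatticeProperties
import Relation.Binary.Reasoning.Setoid as SetoidReasoning

-- If a ≤ b, every element x ∨ (a ∧ b) = x ∨ a of a → b equals 𝟙 ∈ D, so modus ponens gives b ∈ D.
-- For meets, a → (a ∧ b) coincides with a → b, so closure of D under → gives a ∧ b ∈ D.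

module _ {c ℓ : Level} (L : ComplementedLattice c ℓ) where
  open ComplementedLattice L
  open LatticeProperties lattice using (∧-idem)

  imp-≤-≈𝟙 : ∀ {a b x} → _≤_ L a b → (L ⁺) a x → (x ∨ (a ∧ b)) ≈ 𝟙
  imp-≤-≈𝟙 {a} {b} {x} a≤b (a∨x≈𝟙 , _) = begin
    x ∨ (a ∧ b) ≈⟨ ∨-congˡ a≤b ⟩
    x ∨ a       ≈⟨ ∨-comm x a ⟩
    a ∨ x       ≈⟨ a∨x≈𝟙 ⟩
    𝟙           ∎
    where open SetoidReasoning setoid

  ∧-absorbs-∧ : ∀ a b → (a ∧ (a ∧ b)) ≈ (a ∧ b)
  ∧-absorbs-∧ a b = trans (sym (∧-assoc a a b)) (∧-congʳ (∧-idem a))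

  module _ {d : Level} {D : Carrier → Set d} (resp : Respects≈ L D)
           (D𝟙 : D 𝟙) (modus-ponens : ∀ a b → D a → Imp⊆ L a b D → D b) where

    deductiveSystem⇒orderFilter : IsOrderFilter L D
    deductiveSystem⇒orderFilter a b Da a≤b = modus-ponens a b Da λ x x∈a⁺ →
      resp (sym (imp-≤-≈𝟙 a≤b x∈a⁺)) D𝟙

    deductiveSystem⇒∧-closed : (∀ x y → D x → D y → Imp⊆ L x y D) →
                               ∀ a b → D a → D b → D (a ∧ b)
    deductiveSystem⇒∧-closed imp-closed a b Da Db = modus-ponens a (a ∧ b) Da λ x x∈a⁺ →
      resp (∨-congˡ (sym (∧-absorbs-∧ a b))) (imp-closed a b Da Db x x∈a⁺)

lemma5p3 : {c ℓ d : Level} (L : ComplementedLattice c ℓ) (D : ComplementedLattice.Carrier L → Set d) →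
    Respects≈ L D → IsDeductiveSystem L D →
    IsOrderFilter L D × ((∀ x y → D x → D y → Imp⊆ L x y D) → IsFilter L D)
lemma5p3 L D resp (D𝟙 , modus-ponens) =
  upward , λ imp-closed →
    (ComplementedLattice.𝟙 L , D𝟙) , upward , deductiveSystem⇒∧-closed L resp D𝟙 modus-ponens imp-closed
  where
  upward : IsOrderFilter L D
  upward = deductiveSystem⇒orderFilter L resp D𝟙 modus-ponens
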